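{- For every integer $n\geq 1$, the number $\frac{(2n-1)!!+(-1)^{(n-1)(n-2)/2}}{2}$ is a positive integer, and its $2$-adic valuation equals that of $n$: $\nu_2\!\left(\frac{(2n-1)!!+(-1)^{(n-1)(n-2)/2}}{2}\right)=\nu_2(n)$.
   Context: $(2n-1)!!=1\cdot 3\cdot 5\cdots(2n-1)$. For a positive integer $m$, $\nu_2(m)$ denotes the exponent of the highest power of $2$ dividing $m$. -}

module Defs where

open import Data.Nat using (ℕ; zero; suc; _+_; _*_; _∸_; _^_)
open import Data.Nat.DivMod using (_/_; _%_)
open import Data.Integer as ℤ using (ℤ; +_; -_)

-- double factorial of odd numbers: oddDoubleFact n = (2n-1)!! = 1·3·5···(2n-1)
oddDoubleFact : ℕ → ℕ
oddDoubleFact zero    = 1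
oddDoubleFact (suc n) = oddDoubleFact n * (2 * n + 1)

negOnePow : ℕ → ℤ
negOnePow zero    = + 1
negOnePow (suc k) = - negOnePow k

ν₂-aux : ℕ → ℕ → ℕ
ν₂-aux zero       m = 0
ν₂-aux (suc fuel) zero = 0
ν₂-aux (suc fuel) m@(suc _) with m % 2
... | zero  = suc (ν₂-aux fuel (m / 2))
... | suc _ = 0

-- ν₂ m = exponent of the highest power of 2 dividing m (for m ≥ 1; ν₂ 0 = 0 by convention, unused)
ν₂ : ℕ → ℕ
ν₂ m = ν₂-aux m m

{-# OPTIONS --safe #-}
-- Write n = 2^v (1 + 2o) and ε(n) = (-1)^((n-1)(n-2)/2); we show (2n-1)!! + ε(n) = 2^(v+1) · odd by
-- recursion on v. As ε(n) depends only on n mod 4, and four consecutive odd numbers multiply to 1 mod 8,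
-- (2n-1)!! mod 8 depends only on n mod 4, which settles v ≤ 1. For n = 2m with m even, put d = (2m-1)!!
-- and c = 4m: then (4m-1)!! = d · ∏_{i<m} (c - 2i - 1) ≡ d (d - c E) (mod c²) with E ≡ m even, and
-- ε(n) = -1. By induction d + ε(m) = 2^v · odd with v ≥ 2, so d - ε(m) = 2 · odd and
-- d² - 1 = (d - ε(m)) (d + ε(m)) = 2^(v+1) · odd, while c E and c² are multiples of 2^(v+2).
-- Finally (2n-1)!! + ε(n) ≥ 0, so its half is 2^v · odd, which has the valuation of n.
module Submission where

open import Defs

module TwoAdic where
  open import Data.Nat using (zero; suc; _+_; _*_; _^_; _%_; _/_; _≤_; _<_; z<s; s≤s⁻¹)
  open import Data.Nat.Properties using (*-suc; *-comm; *-assoc; *-identityˡ; m<m+n; <-≤-trans; ≤-refl)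
  open import Data.Nat.DivMod using (m*n/n≡m; m*n%n≡0; [m+kn]%n≡m%n)
  open import Data.Nat.Induction using (<-rec)
  open import Data.Product using (∃-syntax; _,_)
  open import Data.Sum using (_⊎_; inj₁; inj₂)
  open import Relation.Binary.PropositionalEquality
  open ≡-Reasoning

  even-or-odd : ∀ n → ∃[ k ] (n ≡ 2 * k ⊎ n ≡ 1 + 2 * k)
  even-or-odd zero = 0 , inj₁ refl
  even-or-odd (suc n) with even-or-odd n
  ... | k , inj₁ refl = k , inj₂ refl
  ... | k , inj₂ refl = suc k , inj₁ (sym (*-suc 2 k))

  [2n]%2≡0 : ∀ n → (2 * n) % 2 ≡ 0
  [2n]%2≡0 n = trans (cong (_% 2) (*-comm 2 n)) (m*n%n≡0 n 2)

  [1+2n]%2≡1 : ∀ n → (1 + 2 * n) % 2 ≡ 1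
  [1+2n]%2≡1 n = trans (cong (λ m → (1 + m) % 2) (*-comm 2 n)) ([m+kn]%n≡m%n 1 n 2)

  [2n]/2≡n : ∀ n → (2 * n) / 2 ≡ n
  [2n]/2≡n n = trans (cong (_/ 2) (*-comm 2 n)) (m*n/n≡m n 2)

  1+n<2[1+n] : ∀ n → suc n < 2 * suc n
  1+n<2[1+n] n = m<m+n (suc n) z<s

  2^[1+v]*m≡2*[2^v*m] : ∀ v m → 2 ^ suc v * m ≡ 2 * (2 ^ v * m)
  2^[1+v]*m≡2*[2^v*m] v m = *-assoc 2 (2 ^ v) m

  2^v*odd≡suc : ∀ v o → ∃[ x ] 2 ^ v * (1 + 2 * o) ≡ suc x
  2^v*odd≡suc zero    o = 2 * o + 0 , refl
  2^v*odd≡suc (suc v) o with 2^v*odd≡suc v o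
  ... | x , eq = x + suc (x + 0) , trans (2^[1+v]*m≡2*[2^v*m] v (1 + 2 * o)) (cong (2 *_) eq)

  2-adic-decomposition : ∀ n → ∃[ v ] ∃[ o ] suc n ≡ 2 ^ v * (1 + 2 * o)
  2-adic-decomposition = <-rec _ decompose
    where
    decompose : ∀ n → (∀ {m} → m < n → ∃[ v ] ∃[ o ] suc m ≡ 2 ^ v * (1 + 2 * o)) →
                ∃[ v ] ∃[ o ] suc n ≡ 2 ^ v * (1 + 2 * o)
    decompose n rec with even-or-odd (suc n)
    ... | o , inj₂ eq = 0 , o , trans eq (sym (*-identityˡ (1 + 2 * o)))
    ... | suc k , inj₁ eq with rec (s≤s⁻¹ (subst (suc k <_) (sym eq) (1+n<2[1+n] k)))
    ...   | v , o , eq′ = suc v , o , trans eq (trans (cong (2 *_) eq′) (sym (2^[1+v]*m≡2*[2^v*m] v (1 + 2 * o))))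

  ν₂-aux-even : ∀ f x → suc x % 2 ≡ 0 → ν₂-aux (suc f) (suc x) ≡ suc (ν₂-aux f (suc x / 2))
  ν₂-aux-even f x even with suc x % 2 | even
  ... | zero | _ = refl

  ν₂-aux-odd : ∀ f x → suc x % 2 ≡ 1 → ν₂-aux (suc f) (suc x) ≡ 0
  ν₂-aux-odd f x odd with suc x % 2 | odd
  ... | suc _ | _ = refl

  ν₂-aux-2^v*odd : ∀ v o f → 2 ^ v * (1 + 2 * o) ≤ f → ν₂-aux f (2 ^ v * (1 + 2 * o)) ≡ v
  ν₂-aux-2^v*odd zero o (suc f) _ =
    subst (λ x → ν₂-aux (suc f) x ≡ 0) (sym (*-identityˡ (1 + 2 * o))) (ν₂-aux-odd f (2 * o) ([1+2n]%2≡1 o))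
  ν₂-aux-2^v*odd (suc v) o f le with 2^v*odd≡suc v o
  ... | x , eq =
    subst (λ y → ν₂-aux f y ≡ suc v) (sym 2^[1+v]*odd≡2[1+x]) (halve f (subst (_≤ f) 2^[1+v]*odd≡2[1+x] le))
    where
    2^[1+v]*odd≡2[1+x] : 2 ^ suc v * (1 + 2 * o) ≡ 2 * suc x
    2^[1+v]*odd≡2[1+x] = trans (2^[1+v]*m≡2*[2^v*m] v (1 + 2 * o)) (cong (2 *_) eq)
    halve : ∀ f → 2 * suc x ≤ f → ν₂-aux f (2 * suc x) ≡ suc v
    halve (suc f) le = begin
      ν₂-aux (suc f) (2 * suc x)      ≡⟨ ν₂-aux-even f _ ([2n]%2≡0 (suc x)) ⟩
      suc (ν₂-aux f (2 * suc x / 2))  ≡⟨ cong (λ y → suc (ν₂-aux f y)) ([2n]/2≡n (suc x)) ⟩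
      suc (ν₂-aux f (suc x))          ≡⟨ cong suc (subst (λ y → ν₂-aux f y ≡ v) eq IH) ⟩
      suc v                           ∎
      where
      IH : ν₂-aux f (2 ^ v * (1 + 2 * o)) ≡ v
      IH = ν₂-aux-2^v*odd v o f (subst (_≤ f) (sym eq) (s≤s⁻¹ (<-≤-trans (1+n<2[1+n] x) le)))

  ν₂-2^v*odd : ∀ v o → ν₂ (2 ^ v * (1 + 2 * o)) ≡ v
  ν₂-2^v*odd v o = ν₂-aux-2^v*odd v o _ ≤-refl

module OddDoubleFactorial where
  open import Data.Nat using (ℕ; zero; suc; _+_; _*_)
  open import Data.Nat.Properties using (+-identityʳ; +-assoc; +-comm; *-distribˡ-+)
  open import Data.Nat.Tactic.RingSolver using (solve-∀)
  open import Data.Product using (∃-syntax; _,_)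
  open import Relation.Binary.PropositionalEquality
  open ≡-Reasoning

  oddDoubleFact-odd : ∀ n → ∃[ d ] oddDoubleFact n ≡ 1 + 2 * d
  oddDoubleFact-odd zero = 0 , refl
  oddDoubleFact-odd (suc n) with oddDoubleFact-odd n
  ... | d , eq = d + n + 2 * d * n , trans (cong (_* (2 * n + 1)) eq) (expand d n)
    where
    expand : ∀ d n → (1 + 2 * d) * (2 * n + 1) ≡ 1 + 2 * (d + n + 2 * d * n)
    expand = solve-∀

  -- The derivative at c = 0 of ∏_{i<n} (c + 2i + 1), i.e. the sum over i < n of ∏_{j≠i} (2j + 1).
  oddDoubleFact′ : ℕ → ℕ
  oddDoubleFact′ zero    = 0
  oddDoubleFact′ (suc n) = oddDoubleFact′ n * (2 * n + 1) + oddDoubleFact n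

  oddDoubleFact′-parity : ∀ n → ∃[ q ] oddDoubleFact′ n ≡ n + 2 * q
  oddDoubleFact′-parity zero = 0 , refl
  oddDoubleFact′-parity (suc n) with oddDoubleFact′-parity n | oddDoubleFact-odd n
  ... | q , eq | d , eq′ = n * n + 2 * n * q + q + d ,
    trans (cong₂ (λ e f → e * (2 * n + 1) + f) eq eq′) (expand n q d)
    where
    expand : ∀ n q d → (n + 2 * q) * (2 * n + 1) + (1 + 2 * d) ≡ 1 + n + 2 * (n * n + 2 * n * q + q + d)
    expand = solve-∀

  -- (2x+1)(2x+7) = 4y + 7 and (2x+3)(2x+5) = 4y + 15 with y = x(x + 4), and (4y + 7)(4y + 15) ≡ 1 (mod 8).
  oddDoubleFact-+4 : ∀ x → ∃[ T ] oddDoubleFact (4 + x) ≡ oddDoubleFact x + 8 * T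
  oddDoubleFact-+4 x = d * (2 * y * y + 11 * y + 13) , (begin
    d * (2 * x + 1) * (2 * (1 + x) + 1) * (2 * (2 + x) + 1) * (2 * (3 + x) + 1)
      ≡⟨ regroup d (2 * x + 1) (2 * (1 + x) + 1) (2 * (2 + x) + 1) (2 * (3 + x) + 1) ⟩
    d * ((2 * x + 1) * (2 * (3 + x) + 1) * ((2 * (1 + x) + 1) * (2 * (2 + x) + 1)))
      ≡⟨ cong₂ (λ u v → d * (u * v)) (outer x) (inner x) ⟩
    d * ((4 * y + 7) * (4 * y + 15))
      ≡⟨ cong (d *_) (product y) ⟩
    d * (1 + 8 * (2 * y * y + 11 * y + 13))
      ≡⟨ distribute d (2 * y * y + 11 * y + 13) ⟩
    d + 8 * (d * (2 * y * y + 11 * y + 13)) ∎)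
    where
    d = oddDoubleFact x
    y = x * (x + 4)
    regroup : ∀ d a b c e → d * a * b * c * e ≡ d * (a * e * (b * c))
    regroup = solve-∀
    outer : ∀ x → (2 * x + 1) * (2 * (3 + x) + 1) ≡ 4 * (x * (x + 4)) + 7
    outer = solve-∀
    inner : ∀ x → (2 * (1 + x) + 1) * (2 * (2 + x) + 1) ≡ 4 * (x * (x + 4)) + 15
    inner = solve-∀
    product : ∀ y → (4 * y + 7) * (4 * y + 15) ≡ 1 + 8 * (2 * y * y + 11 * y + 13)
    product = solve-∀
    distribute : ∀ d q → d * (1 + 8 * q) ≡ d + 8 * (d * q)
    distribute = solve-∀

  oddDoubleFact-mod8 : ∀ r k → ∃[ T ] oddDoubleFact (r + k * 4) ≡ oddDoubleFact r + 8 * T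
  oddDoubleFact-mod8 r zero = 0 , trans (cong oddDoubleFact (+-identityʳ r)) (sym (+-identityʳ _))
  oddDoubleFact-mod8 r (suc k) =
    -- not with: with-abstraction would normalise the ring-solver proof inside oddDoubleFact-+4
    let T , eq = oddDoubleFact-mod8 r k
        U , eq′ = oddDoubleFact-+4 (r + k * 4)
    in T + U , (begin
      oddDoubleFact (r + (4 + k * 4))          ≡⟨ cong oddDoubleFact (+-shift r (k * 4)) ⟩
      oddDoubleFact (4 + (r + k * 4))          ≡⟨ eq′ ⟩
      oddDoubleFact (r + k * 4) + 8 * U        ≡⟨ cong (_+ 8 * U) eq ⟩
      oddDoubleFact r + 8 * T + 8 * U          ≡⟨ +-assoc (oddDoubleFact r) (8 * T) (8 * U) ⟩
      oddDoubleFact r + (8 * T + 8 * U)        ≡⟨ cong (oddDoubleFact r +_) (*-distribˡ-+ 8 T U) ⟨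
      oddDoubleFact r + 8 * (T + U)            ∎)
    where
    +-shift : ∀ r y → r + (4 + y) ≡ 4 + (r + y)
    +-shift r y = trans (sym (+-assoc r 4 y)) (trans (cong (_+ y) (+-comm r 4)) (+-assoc 4 r y))

module Sign where
  open import Data.Nat using (ℕ; zero; suc; _+_; _*_; _∸_; _/_)
  open import Data.Nat.DivMod using (m*n/n≡m)
  open import Data.Nat.Tactic.RingSolver using (solve-∀)
  open import Data.Integer using (ℤ; -_; 1ℤ; -1ℤ)
  open import Data.Integer.Properties using (neg-involutive)
  open import Data.Sum using (_⊎_; inj₁; inj₂)
  open import Relation.Binary.PropositionalEquality

  negOnePow-even : ∀ k → negOnePow (k * 2) ≡ 1ℤ
  negOnePow-even zero    = refl
  negOnePow-even (suc k) = trans (neg-involutive _) (negOnePow-even k)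

  negOnePow-odd : ∀ k → negOnePow (1 + k * 2) ≡ -1ℤ
  negOnePow-odd k = cong -_ (negOnePow-even k)

  negOnePow-±1 : ∀ k → negOnePow k ≡ 1ℤ ⊎ negOnePow k ≡ -1ℤ
  negOnePow-±1 zero = inj₁ refl
  negOnePow-±1 (suc k) with negOnePow-±1 k
  ... | inj₁ eq = inj₂ (cong -_ eq)
  ... | inj₂ eq = inj₁ (cong -_ eq)

  sign : ℕ → ℤ
  sign n = negOnePow (((n ∸ 1) * (n ∸ 2)) / 2)

  sign-even : ∀ n k → (n ∸ 1) * (n ∸ 2) ≡ k * 2 * 2 → sign n ≡ 1ℤ
  sign-even n k eq =
    trans (cong (λ y → negOnePow (y / 2)) eq) (trans (cong negOnePow (m*n/n≡m (k * 2) 2)) (negOnePow-even k))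

  sign-odd : ∀ n k → (n ∸ 1) * (n ∸ 2) ≡ (1 + k * 2) * 2 → sign n ≡ -1ℤ
  sign-odd n k eq =
    trans (cong (λ y → negOnePow (y / 2)) eq) (trans (cong negOnePow (m*n/n≡m (1 + k * 2) 2)) (negOnePow-odd k))

  sign-1+4k : ∀ k → sign (1 + k * 4) ≡ 1ℤ
  sign-1+4k k = sign-even (1 + k * 4) (k * (k * 4 ∸ 1)) (factor k (k * 4 ∸ 1))
    where
    factor : ∀ k y → k * 4 * y ≡ k * y * 2 * 2
    factor = solve-∀

  sign-2+4k : ∀ k → sign (2 + k * 4) ≡ 1ℤ
  sign-2+4k k = sign-even (2 + k * 4) ((1 + k * 4) * k) (factor k)
    where
    factor : ∀ k → (1 + k * 4) * (k * 4) ≡ (1 + k * 4) * k * 2 * 2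
    factor = solve-∀

  sign-3+4k : ∀ k → sign (3 + k * 4) ≡ -1ℤ
  sign-3+4k k = sign-odd (3 + k * 4) (k * 3 + k * k * 4) (factor k)
    where
    factor : ∀ k → (2 + k * 4) * (1 + k * 4) ≡ (1 + (k * 3 + k * k * 4) * 2) * 2
    factor = solve-∀

  sign-4+4k : ∀ k → sign (4 + k * 4) ≡ -1ℤ
  sign-4+4k k = sign-odd (4 + k * 4) (1 + k * 5 + k * k * 4) (factor k)
    where
    factor : ∀ k → (3 + k * 4) * (2 + k * 4) ≡ (1 + (1 + k * 5 + k * k * 4) * 2) * 2
    factor = solve-∀

  sign-±1 : ∀ n → sign n ≡ 1ℤ ⊎ sign n ≡ -1ℤ
  sign-±1 n = negOnePow-±1 (((n ∸ 1) * (n ∸ 2)) / 2)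

module OddMultiples where
  import Data.Nat as ℕ
  open import Data.Integer using (ℤ; +_; -[1+_]; _+_; _*_; _-_; -_; ∣_∣; 1ℤ; -1ℤ)
  open import Data.Integer.Properties using (pos-+; pos-*; abs-*; ∣-i∣≡∣i∣)
  open import Data.Integer.Tactic.RingSolver using (solve-∀)
  open import Data.Product using (∃-syntax; _,_)
  open import Data.Sum using (_⊎_; inj₁; inj₂)
  open import Relation.Binary.PropositionalEquality
  open ≡-Reasoning

  OddMultiple : ℤ → ℤ → Set
  OddMultiple a x = ∃[ t ] x ≡ a * (1ℤ + + 2 * t)

  oddMultiple-* : ∀ {a b x y} → OddMultiple a x → OddMultiple b y → OddMultiple (a * b) (x * y)
  oddMultiple-* {a} {b} (t , refl) (u , refl) = t + u + + 2 * t * u , expand a b t u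
    where
    expand : ∀ a b t u → a * (1ℤ + + 2 * t) * (b * (1ℤ + + 2 * u)) ≡ a * b * (1ℤ + + 2 * (t + u + + 2 * t * u))
    expand = solve-∀

  oddMultiple-+ : ∀ {a x} → OddMultiple a x → ∀ y → OddMultiple a (x + + 2 * a * y)
  oddMultiple-+ {a} (t , refl) y = t + y , expand a t y
    where
    expand : ∀ a t y → a * (1ℤ + + 2 * t) + + 2 * a * y ≡ a * (1ℤ + + 2 * (t + y))
    expand = solve-∀

  oddMultiple-conjugate : ∀ {p d s} → s ≡ 1ℤ ⊎ s ≡ -1ℤ →
    OddMultiple (+ 2 * (+ 2 * p)) (d + s) → OddMultiple (+ 2) (d - s)
  oddMultiple-conjugate {p} {d} (inj₁ refl) (t , eq) = p * (1ℤ + + 2 * t) - 1ℤ ,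
    trans (shift d) (trans (cong (_- + 2) eq) (expand p t))
    where
    shift : ∀ d → d - 1ℤ ≡ (d + 1ℤ) - + 2
    shift = solve-∀
    expand : ∀ p t → + 2 * (+ 2 * p) * (1ℤ + + 2 * t) - + 2 ≡ + 2 * (1ℤ + + 2 * (p * (1ℤ + + 2 * t) - 1ℤ))
    expand = solve-∀
  oddMultiple-conjugate {p} {d} (inj₂ refl) (t , eq) = p * (1ℤ + + 2 * t) ,
    trans (shift d) (trans (cong (_+ + 2) eq) (expand p t))
    where
    shift : ∀ d → d - -1ℤ ≡ (d + -1ℤ) + + 2
    shift = solve-∀
    expand : ∀ p t → + 2 * (+ 2 * p) * (1ℤ + + 2 * t) + + 2 ≡ + 2 * (1ℤ + + 2 * (p * (1ℤ + + 2 * t)))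
    expand = solve-∀

  pos-1+2n : ∀ n → + (1 ℕ.+ 2 ℕ.* n) ≡ 1ℤ + + 2 * + n
  pos-1+2n n = trans (pos-+ 1 (2 ℕ.* n)) (cong (λ y → 1ℤ + y) (pos-* 2 n))

  ∣1+2t∣-odd : ∀ t → ∃[ o ] ∣ 1ℤ + + 2 * t ∣ ≡ 1 ℕ.+ 2 ℕ.* o
  ∣1+2t∣-odd (+ n)    = n , cong ∣_∣ (sym (pos-1+2n n))
  ∣1+2t∣-odd -[1+ n ] = n , (begin
    ∣ 1ℤ + + 2 * -[1+ n ] ∣        ≡⟨ cong ∣_∣ (reflect (+ n)) ⟩
    ∣ - (1ℤ + + 2 * + n) ∣         ≡⟨ ∣-i∣≡∣i∣ (1ℤ + + 2 * + n) ⟩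
    ∣ 1ℤ + + 2 * + n ∣             ≡⟨ cong ∣_∣ (sym (pos-1+2n n)) ⟩
    1 ℕ.+ 2 ℕ.* n                  ∎)
    where
    reflect : ∀ m → 1ℤ + + 2 * (- (1ℤ + m)) ≡ - (1ℤ + + 2 * m)
    reflect = solve-∀

  oddMultiple-ℕ : ∀ {a x} → OddMultiple (+ a) (+ x) → ∃[ o ] x ≡ a ℕ.* (1 ℕ.+ 2 ℕ.* o)
  oddMultiple-ℕ {a} (t , eq) with ∣1+2t∣-odd t
  ... | o , odd = o , trans (cong ∣_∣ eq) (trans (abs-* (+ a) (1ℤ + + 2 * t)) (cong (a ℕ.*_) odd))

module DoubleFactPlusSign where
  open import Data.Nat as ℕ using (ℕ; zero; suc)
  import Data.Nat.Properties as ℕₚ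
  import Data.Nat.Tactic.RingSolver as ℕ-Solver
  open import Data.Integer using (ℤ; +_; _+_; _*_; _-_; -_; _^_; 1ℤ; -1ℤ)
  open import Data.Integer.Properties using (pos-+; pos-*; *-identityʳ; *-assoc; *-comm)
  open import Data.Integer.Tactic.RingSolver using (solve-∀)
  open import Data.Product using (∃-syntax; _,_)
  open import Data.Sum using (_⊎_; inj₁; inj₂)
  open import Function using (_∘_)
  open import Relation.Binary.PropositionalEquality
  open ≡-Reasoning
  open TwoAdic using (even-or-odd; 2^v*odd≡suc)
  open OddDoubleFactorial
  open Sign
  open OddMultiples

  pos-^ : ∀ m n → + (m ℕ.^ n) ≡ (+ m) ^ n
  pos-^ m zero    = refl
  pos-^ m (suc n) = trans (pos-* m (m ℕ.^ n)) (cong (+ m *_) (pos-^ m n))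

  doubleFactPlusSign : ℕ → ℤ
  doubleFactPlusSign n = + oddDoubleFact n + sign n

  doubleFactPlusSign-nonneg : ∀ n → ∃[ K ] doubleFactPlusSign n ≡ + K
  doubleFactPlusSign-nonneg n with sign-±1 n
  ... | inj₁ s≡1 = oddDoubleFact n ℕ.+ 1 , cong (λ s → + oddDoubleFact n + s) s≡1
  ... | inj₂ s≡-1 with oddDoubleFact-odd n
  ...   | d , eq = 2 ℕ.* d , (begin
    + oddDoubleFact n + sign n      ≡⟨ cong₂ _+_ (trans (cong +_ eq) (pos-1+2n d)) s≡-1 ⟩
    1ℤ + + 2 * + d + -1ℤ            ≡⟨ cancel (+ d) ⟩
    + 2 * + d                       ≡⟨ pos-* 2 d ⟨
    + (2 ℕ.* d)                     ∎)
    where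
    cancel : ∀ x → 1ℤ + + 2 * x + -1ℤ ≡ + 2 * x
    cancel = solve-∀

  doubleFactPlusSign-mod8 : ∀ r k {s} → sign (r ℕ.+ k ℕ.* 4) ≡ s →
    ∃[ T ] doubleFactPlusSign (r ℕ.+ k ℕ.* 4) ≡ + oddDoubleFact r + s + + 8 * T
  doubleFactPlusSign-mod8 r k {s} sign≡s =
    let T , eq = oddDoubleFact-mod8 r k in + T , (begin
    + oddDoubleFact (r ℕ.+ k ℕ.* 4) + sign (r ℕ.+ k ℕ.* 4)  ≡⟨ cong₂ _+_ (cong +_ eq) sign≡s ⟩
    + (oddDoubleFact r ℕ.+ 8 ℕ.* T) + s                      ≡⟨ cong (_+ s) (pos-a+8t (oddDoubleFact r) T) ⟩
    + oddDoubleFact r + + 8 * + T + s                        ≡⟨ swap (+ oddDoubleFact r) (+ T) s ⟩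
    + oddDoubleFact r + s + + 8 * + T                        ∎)
    where
    pos-a+8t : ∀ a t → + (a ℕ.+ 8 ℕ.* t) ≡ + a + + 8 * + t
    pos-a+8t a t = trans (pos-+ a (8 ℕ.* t)) (cong (λ y → + a + y) (pos-* 8 t))
    swap : ∀ a t s → a + + 8 * t + s ≡ a + s + + 8 * t
    swap = solve-∀

  doubleFactPlusSign-1+4k : ∀ k → OddMultiple (+ 2) (doubleFactPlusSign (1 ℕ.+ k ℕ.* 4))
  doubleFactPlusSign-1+4k k =
    let T , eq = doubleFactPlusSign-mod8 1 k (sign-1+4k k) in + 2 * T , trans eq (expand T)
    where
    expand : ∀ T → + 1 + 1ℤ + + 8 * T ≡ + 2 * (1ℤ + + 2 * (+ 2 * T))
    expand = solve-∀

  doubleFactPlusSign-2+4k : ∀ k → OddMultiple (+ 4) (doubleFactPlusSign (2 ℕ.+ k ℕ.* 4))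
  doubleFactPlusSign-2+4k k =
    let T , eq = doubleFactPlusSign-mod8 2 k (sign-2+4k k) in T , trans eq (expand T)
    where
    expand : ∀ T → + 3 + 1ℤ + + 8 * T ≡ + 4 * (1ℤ + + 2 * T)
    expand = solve-∀

  doubleFactPlusSign-3+4k : ∀ k → OddMultiple (+ 2) (doubleFactPlusSign (3 ℕ.+ k ℕ.* 4))
  doubleFactPlusSign-3+4k k =
    let T , eq = doubleFactPlusSign-mod8 3 k (sign-3+4k k) in + 3 + + 2 * T , trans eq (expand T)
    where
    expand : ∀ T → + 15 + -1ℤ + + 8 * T ≡ + 2 * (1ℤ + + 2 * (+ 3 + + 2 * T))
    expand = solve-∀

  oddsBelow : ℤ → ℕ → ℤ
  oddsBelow c zero    = 1ℤ
  oddsBelow c (suc i) = oddsBelow c i * (c - + (2 ℕ.* i ℕ.+ 1))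

  oddsBelow-expansion : ∀ c k →
    ∃[ R ] oddsBelow c k ≡ negOnePow k * (+ oddDoubleFact k - c * + oddDoubleFact′ k) + c * c * R
  oddsBelow-expansion c zero = + 0 , base c
    where
    base : ∀ c → 1ℤ ≡ 1ℤ * (1ℤ - c * + 0) + c * c * + 0
    base = solve-∀
  oddsBelow-expansion c (suc k) with oddsBelow-expansion c k
  ... | R , eq = R * (c - a) - s * e , (begin
    oddsBelow c k * (c - a)
      ≡⟨ cong (_* (c - a)) eq ⟩
    (s * (d - c * e) + c * c * R) * (c - a)
      ≡⟨ step s d c e R a ⟩
    - s * (d * a - c * (e * a + d)) + c * c * (R * (c - a) - s * e)
      ≡⟨ cong₂ (λ x y → - s * (x - c * y) + c * c * (R * (c - a) - s * e)) d′ e′ ⟩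
    - s * (+ oddDoubleFact (suc k) - c * + oddDoubleFact′ (suc k)) + c * c * (R * (c - a) - s * e) ∎)
    where
    a = + (2 ℕ.* k ℕ.+ 1)
    s = negOnePow k
    d = + oddDoubleFact k
    e = + oddDoubleFact′ k
    d′ : d * a ≡ + oddDoubleFact (suc k)
    d′ = sym (pos-* (oddDoubleFact k) _)
    e′ : e * a + d ≡ + oddDoubleFact′ (suc k)
    e′ = sym (trans (pos-+ (oddDoubleFact′ k ℕ.* _) _) (cong (_+ d) (pos-* (oddDoubleFact′ k) _)))
    step : ∀ s d c e R a → (s * (d - c * e) + c * c * R) * (c - a)
                         ≡ - s * (d * a - c * (e * a + d)) + c * c * (R * (c - a) - s * e)
    step = solve-∀

  oddDoubleFact-split : ∀ r k → + oddDoubleFact (r ℕ.+ k) ≡ + oddDoubleFact r * oddsBelow (+ (2 ℕ.* (r ℕ.+ k))) k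
  oddDoubleFact-split r zero rewrite ℕₚ.+-identityʳ r = sym (*-identityʳ _)
  oddDoubleFact-split r (suc k) rewrite ℕₚ.+-suc r k = begin
    + oddDoubleFact (suc r ℕ.+ k)            ≡⟨ oddDoubleFact-split (suc r) k ⟩
    + oddDoubleFact (suc r) * V              ≡⟨ cong (_* V) (pos-* (oddDoubleFact r) _) ⟩
    + oddDoubleFact r * + (2 ℕ.* r ℕ.+ 1) * V ≡⟨ cong (λ x → + oddDoubleFact r * x * V) (sym gap) ⟩
    + oddDoubleFact r * (c - b) * V          ≡⟨ *-assoc (+ oddDoubleFact r) (c - b) V ⟩
    + oddDoubleFact r * ((c - b) * V)        ≡⟨ cong (+ oddDoubleFact r *_) (*-comm (c - b) V) ⟩
    + oddDoubleFact r * (V * (c - b))        ∎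
    where
    c = + (2 ℕ.* suc (r ℕ.+ k))
    b = + (2 ℕ.* k ℕ.+ 1)
    V = oddsBelow c k
    split : ∀ r k → 2 ℕ.* suc (r ℕ.+ k) ≡ (2 ℕ.* r ℕ.+ 1) ℕ.+ (2 ℕ.* k ℕ.+ 1)
    split = ℕ-Solver.solve-∀
    cancel : ∀ x y → x + y - y ≡ x
    cancel = solve-∀
    gap : c - b ≡ + (2 ℕ.* r ℕ.+ 1)
    gap = trans (cong (λ x → + x - b) (split r k)) (trans (cong (_- b) (pos-+ (2 ℕ.* r ℕ.+ 1) _)) (cancel _ b))

  conjugate-product : ∀ {d s} → s ≡ 1ℤ ⊎ s ≡ -1ℤ → (d - s) * (d + s) ≡ d * d + -1ℤ
  conjugate-product {d} (inj₁ refl) = expand d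
    where
    expand : ∀ d → (d - 1ℤ) * (d + 1ℤ) ≡ d * d + -1ℤ
    expand = solve-∀
  conjugate-product {d} (inj₂ refl) = expand d
    where
    expand : ∀ d → (d - -1ℤ) * (d + -1ℤ) ≡ d * d + -1ℤ
    expand = solve-∀

  -- With c = 8p(1 + 2o) and E = 2(p(1 + 2o) + q), both d c E and d c² R are multiples of 16p.
  oddMultiple-doubling : ∀ {p o q R d s M E c} → s ≡ 1ℤ ⊎ s ≡ -1ℤ →
    OddMultiple (+ 2 * (+ 2 * p)) (d + s) →
    M ≡ + 2 * p * (1ℤ + + 2 * o) → E ≡ M + + 2 * q → c ≡ + 2 * (M + M) →
    OddMultiple (+ 2 * (+ 2 * (+ 2 * p))) (d * (1ℤ * (d - c * E) + c * c * R) + -1ℤ)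
  oddMultiple-doubling {p} {o} {q} {R} {d} {s} s≡±1 d+s refl refl refl =
    subst (OddMultiple a) (sym (begin
      d * (1ℤ * (d - c * E) + c * c * R) + -1ℤ   ≡⟨ expand p o q R d ⟩
      d * d + -1ℤ + + 2 * a * W                  ≡⟨ cong (_+ + 2 * a * W) (conjugate-product {d} s≡±1) ⟨
      (d - s) * (d + s) + + 2 * a * W            ∎))
      (oddMultiple-+ {a} (oddMultiple-* {+ 2} {+ 2 * (+ 2 * p)} (oddMultiple-conjugate {p} {d} s≡±1 d+s) d+s) W)
    where
    M = + 2 * p * (1ℤ + + 2 * o)
    E = M + + 2 * q
    c = + 2 * (M + M)
    a = + 2 * (+ 2 * (+ 2 * p))
    W = + 4 * p * (1ℤ + + 2 * o) * (1ℤ + + 2 * o) * d * R - d * (1ℤ + + 2 * o) * (p * (1ℤ + + 2 * o) + q)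
    expand : ∀ p o q R d →
      let M = + 2 * p * (1ℤ + + 2 * o); c = + 2 * (M + M) in
      d * (1ℤ * (d - c * (M + + 2 * q)) + c * c * R) + -1ℤ
        ≡ d * d + -1ℤ + + 2 * (+ 2 * (+ 2 * (+ 2 * p)))
            * (+ 4 * p * (1ℤ + + 2 * o) * (1ℤ + + 2 * o) * d * R - d * (1ℤ + + 2 * o) * (p * (1ℤ + + 2 * o) + q))
    expand = solve-∀

  doubleFactPlusSign-double : ∀ {w o m} → m ≡ 2 ℕ.^ suc w ℕ.* (1 ℕ.+ 2 ℕ.* o) →
    OddMultiple ((+ 2) ^ suc (suc w)) (doubleFactPlusSign m) →
    OddMultiple ((+ 2) ^ suc (suc (suc w))) (doubleFactPlusSign (m ℕ.+ m))
  doubleFactPlusSign-double {w} {o} {m} m≡ IH =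
    let R , expansion = oddsBelow-expansion c m
        q , parity = oddDoubleFact′-parity m
    in subst (OddMultiple ((+ 2) ^ suc (suc (suc w)))) (sym (begin
      + oddDoubleFact (m ℕ.+ m) + sign (m ℕ.+ m)          ≡⟨ cong₂ _+_ (oddDoubleFact-split m m) sign[m+m]≡-1 ⟩
      d * oddsBelow c m + -1ℤ                             ≡⟨ cong (λ V → d * V + -1ℤ) expansion ⟩
      d * (negOnePow m * (d - c * e) + c * c * R) + -1ℤ   ≡⟨ cong (λ s → d * (s * (d - c * e) + c * c * R) + -1ℤ)
                                                                 [-1]^m≡1 ⟩
      d * (1ℤ * (d - c * e) + c * c * R) + -1ℤ            ∎))
      (oddMultiple-doubling {(+ 2) ^ w} {+ o} {+ q} {R} {d} (sign-±1 m) IH +m≡ (+oddDoubleFact′≡ {q} parity) +c≡)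
    where
    d = + oddDoubleFact m
    e = + oddDoubleFact′ m
    c = + (2 ℕ.* (m ℕ.+ m))
    half = 2 ℕ.^ w ℕ.* (1 ℕ.+ 2 ℕ.* o)
    m≡half*2 : m ≡ half ℕ.* 2
    m≡half*2 = trans m≡ (regroup (2 ℕ.^ w) (1 ℕ.+ 2 ℕ.* o))
      where
      regroup : ∀ p y → 2 ℕ.* p ℕ.* y ≡ p ℕ.* y ℕ.* 2
      regroup = ℕ-Solver.solve-∀
    [-1]^m≡1 : negOnePow m ≡ 1ℤ
    [-1]^m≡1 = trans (cong negOnePow m≡half*2) (negOnePow-even half)
    m+m≡half*4 : m ℕ.+ m ≡ half ℕ.* 4
    m+m≡half*4 = trans (cong₂ ℕ._+_ m≡half*2 m≡half*2) (double half)
      where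
      double : ∀ h → h ℕ.* 2 ℕ.+ h ℕ.* 2 ≡ h ℕ.* 4
      double = ℕ-Solver.solve-∀
    sign[m+m]≡-1 : sign (m ℕ.+ m) ≡ -1ℤ
    sign[m+m]≡-1 with 2^v*odd≡suc w o
    ... | x , half≡1+x = begin
      sign (m ℕ.+ m)       ≡⟨ cong sign m+m≡half*4 ⟩
      sign (half ℕ.* 4)    ≡⟨ cong (λ y → sign (y ℕ.* 4)) half≡1+x ⟩
      sign (suc x ℕ.* 4)   ≡⟨ sign-4+4k x ⟩
      -1ℤ                  ∎
    +m≡ : + m ≡ + 2 * (+ 2) ^ w * (1ℤ + + 2 * + o)
    +m≡ = trans (cong +_ m≡) (trans (pos-* (2 ℕ.^ suc w) _) (cong₂ _*_ (pos-^ 2 (suc w)) (pos-1+2n o)))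
    +oddDoubleFact′≡ : ∀ {q} → oddDoubleFact′ m ≡ m ℕ.+ 2 ℕ.* q → e ≡ + m + + 2 * + q
    +oddDoubleFact′≡ {q} eq = trans (cong +_ eq) (trans (pos-+ m _) (cong (λ z → + m + z) (pos-* 2 q)))
    +c≡ : c ≡ + 2 * (+ m + + m)
    +c≡ = trans (pos-* 2 (m ℕ.+ m)) (cong (λ z → + 2 * z) (pos-+ m m))

  doubleFactPlusSign-oddMultiple : ∀ v o →
    OddMultiple ((+ 2) ^ suc v) (doubleFactPlusSign (2 ℕ.^ v ℕ.* (1 ℕ.+ 2 ℕ.* o)))
  doubleFactPlusSign-oddMultiple zero o with even-or-odd o
  ... | k , inj₁ refl = subst (OddMultiple (+ 2) ∘ doubleFactPlusSign) (reshape k) (doubleFactPlusSign-1+4k k)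
    where
    reshape : ∀ k → 1 ℕ.+ k ℕ.* 4 ≡ 1 ℕ.* (1 ℕ.+ 2 ℕ.* (2 ℕ.* k))
    reshape = ℕ-Solver.solve-∀
  ... | k , inj₂ refl = subst (OddMultiple (+ 2) ∘ doubleFactPlusSign) (reshape k) (doubleFactPlusSign-3+4k k)
    where
    reshape : ∀ k → 3 ℕ.+ k ℕ.* 4 ≡ 1 ℕ.* (1 ℕ.+ 2 ℕ.* (1 ℕ.+ 2 ℕ.* k))
    reshape = ℕ-Solver.solve-∀
  doubleFactPlusSign-oddMultiple (suc zero) o =
    subst (OddMultiple (+ 4) ∘ doubleFactPlusSign) (reshape o) (doubleFactPlusSign-2+4k o)
    where
    reshape : ∀ o → 2 ℕ.+ o ℕ.* 4 ≡ 2 ℕ.* 1 ℕ.* (1 ℕ.+ 2 ℕ.* o)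
    reshape = ℕ-Solver.solve-∀
  doubleFactPlusSign-oddMultiple (suc (suc w)) o =
    subst (OddMultiple ((+ 2) ^ suc (suc (suc w))) ∘ doubleFactPlusSign) (sym (reshape (2 ℕ.^ w) (1 ℕ.+ 2 ℕ.* o)))
      (doubleFactPlusSign-double {w} {o} refl (doubleFactPlusSign-oddMultiple (suc w) o))
    where
    reshape : ∀ p y → 2 ℕ.* (2 ℕ.* p) ℕ.* y ≡ 2 ℕ.* p ℕ.* y ℕ.+ 2 ℕ.* p ℕ.* y
    reshape = ℕ-Solver.solve-∀

  half-doubleFactPlusSign : ∀ v o →
    ∃[ o′ ] + (2 ℕ.* (2 ℕ.^ v ℕ.* (1 ℕ.+ 2 ℕ.* o′))) ≡ doubleFactPlusSign (2 ℕ.^ v ℕ.* (1 ℕ.+ 2 ℕ.* o))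
  half-doubleFactPlusSign v o =
    let K , N≡K = doubleFactPlusSign-nonneg (2 ℕ.^ v ℕ.* (1 ℕ.+ 2 ℕ.* o))
        o′ , K≡ = oddMultiple-ℕ {2 ℕ.^ suc v} {K}
                    (subst₂ OddMultiple (sym (pos-^ 2 (suc v))) N≡K (doubleFactPlusSign-oddMultiple v o))
    in o′ , (begin
      + (2 ℕ.* (2 ℕ.^ v ℕ.* (1 ℕ.+ 2 ℕ.* o′)))  ≡⟨ cong +_ (ℕₚ.*-assoc 2 (2 ℕ.^ v) _) ⟨
      + (2 ℕ.^ suc v ℕ.* (1 ℕ.+ 2 ℕ.* o′))      ≡⟨ cong +_ K≡ ⟨
      + K                                        ≡⟨ N≡K ⟨
      doubleFactPlusSign (2 ℕ.^ v ℕ.* (1 ℕ.+ 2 ℕ.* o)) ∎)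

open import Data.Nat as ℕ using (ℕ; suc; _≥_; _>_; _∸_; _*_; _/_; _^_; s≤s; z≤n)
open import Data.Integer using (+_; _+_)
open import Data.Product using (Σ; _×_; _,_)
open import Relation.Binary.PropositionalEquality using (_≡_; subst; sym; trans; cong)
open TwoAdic using (2-adic-decomposition; 2^v*odd≡suc; ν₂-2^v*odd)
open DoubleFactPlusSign using (doubleFactPlusSign; half-doubleFactPlusSign)

theorem1 : (n : ℕ) → n ≥ 1 →
    Σ ℕ (λ m → (m > 0) ×
    ((+ (2 * m)) ≡ ((+ oddDoubleFact n) + negOnePow (((n ∸ 1) * (n ∸ 2)) / 2))) ×
    (ν₂ m ≡ ν₂ n))
theorem1 (suc n) _ =
  let v , o , n≡2^v*odd = 2-adic-decomposition n
      o′ , 2m≡ = half-doubleFactPlusSign v o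
      x , m≡suc = 2^v*odd≡suc v o′
  in 2 ^ v * (1 ℕ.+ 2 * o′)
   , subst (_> 0) (sym m≡suc) (s≤s z≤n)
   , trans 2m≡ (cong doubleFactPlusSign (sym n≡2^v*odd))
   , trans (ν₂-2^v*odd v o′) (sym (trans (cong ν₂ n≡2^v*odd) (ν₂-2^v*odd v o)))
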